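{- Let $C$ be a coin fountain with $d\geq 1$ north-east diagonals and let $k=\mathrm{diag}(C)$. Then the recursive construction of $f(C)$ is well defined and $P=f(C)$ is a Stanley polyomino with $d+1$ columns satisfying: \begin{itemize} \item if $k=2\ell$ with $\ell\geq 1$, then $\mathrm{firstD}(P)=\ell$ and $\mathrm{firstR}(P)\geq \ell+2$; \item if $k=2\ell+1$ with $\ell\geq 0$, then $\mathrm{firstD}(P)\geq \ell+1$ and $\mathrm{firstR}(P)=\ell+2$. \end{itemize}
   Context: Stanley polyominoes: cells are unit squares $[i,i+1]\times[j,j+1]$; a Stanley polyomino (up to translation) is a set of cells forming $k\ge1$ rows $0,\dots,k-1$ (bottom to top), row $j$ consisting of the cells with $s_j\le i\le e_j$, such that $s_{j-1}<s_j\le e_{j-1}<e_j$ for $1\le j\le k-1$; its number of columns is $e_{k-1}-s_0+1$. $\mathrm{firstR}(P)=e_0-s_0+1$ is the number of cells of the first (bottom) row, and $\mathrm{firstD}(P)$ is the largest $m$ such that the cells $[s_0+j,s_0+j+1]\times[j,j+1]$, $0\le j\le m-1$, all belong to $P$ (the number of cells in the first north-east diagonal). Coin fountains: a coin fountain with $d\geq1$ diagonals is a finite set $C\subset\mathbb{Z}\times\mathbb{Z}_{\ge0}$ (positions of coins) whose row $0$ is $\{(2i,0):0\le i\le d-1\}$ and such that every $(a,j)\in C$ with $j\geq1$ has $(a-1,j-1)\in C$ and $(a+1,j-1)\in C$. The $i$-th north-east diagonal ($0\le i\le d-1$) consists of the coins $(2i+j,j)\in C$; $\mathrm{diag}(C)$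 is the number of coins on the first diagonal $i=0$. If $d\geq2$, $C'$ denotes the coin fountain $\{(a-2,j):(a,j)\in C,\ a-j\geq 2\}$ obtained by deleting the first diagonal (it has $d-1$ diagonals). The map $f$: if $C$ is a single coin ($d=1$), $f(C)$ is the single row of two cells. If $d\geq2$, let $k=\mathrm{diag}(C)$ and $P'=f(C')$ with rows $0,\dots,m-1$ given by $s_j,e_j$. If $k=2\ell+1$ ($\ell\ge0$), $f(C)$ is obtained by adding below $P'$ a new bottom row of $\ell+2$ cells whose leftmost cell lies one unit to the left of the leftmost cell of the bottom row of $P'$ (i.e. new bottom row occupies $s_0-1\le i\le s_0+\ell$, and the old rows move up by one). If $k=2\ell$ ($\ell\geq1$), $f(C)$ is obtained from $P'$ by adding one cell at the left end of each of the first (lowest) $\ell$ rows (i.e. replacing $s_j$ by $s_j-1$ for $0\le j\le \ell-1$). -}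

module Defs where

open import Data.Nat as ℕ using (ℕ; zero; suc; _%_; _/_)
open import Data.Integer as ℤ using (ℤ; +_; _+_; _-_; _≤_; _<_; _≟_; _≤?_)
open import Data.Product using (_×_; _,_; ∃-syntax; Σ-syntax; proj₁; proj₂)
open import Relation.Nullary using (yes; no)
open import Data.List using (List; []; _∷_; length; filter; map)
open import Data.List.Membership.Propositional using (_∈_)
open import Data.List.Relation.Unary.All using (All)
open import Data.List.Relation.Unary.Unique.Propositional using (Unique)
open import Data.Unit using (⊤)
open import Relation.Binary.PropositionalEquality using (_≡_)
open import Function.Bundles using (_⇔_)

Coin : Set
Coin = ℤ × ℕ

record IsCoinFountain (d : ℕ) (C : List Coin) : Set where
  field
    noDup   : Unique C
    row0    : ∀ (a : ℤ) → ((a , 0) ∈ C) ⇔ (∃[ i ] (i ℕ.< d × a ≡ + (2 ℕ.* i)))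
    support : ∀ (a : ℤ) (j : ℕ) → (a , suc j) ∈ C →
                ((a - + 1 , j) ∈ C) × ((a + + 1 , j) ∈ C)

diag : List Coin → ℕ
diag C = length (filter (λ c → ℤ._≟_ (proj₁ c) (+ proj₂ c)) C)

-- C' : delete the first diagonal and shift by 2 to the left.
delFirstDiag : List Coin → List Coin
delFirstDiag C =
  map (λ c → (proj₁ c - + 2 , proj₂ c))
      (filter (λ c → + 2 ≤? (proj₁ c - + (proj₂ c))) C)

-- Polyominoes given row by row (bottom to top): row j = (s_j , e_j),
-- consisting of the cells [i,i+1]×[j,j+1] with s_j ≤ i ≤ e_j.

Row : Set
Row = ℤ × ℤ

Rows : Set
Rows = List Row

Chain : Rows → Set
Chain [] = ⊤
Chain (_ ∷ []) = ⊤
Chain ((s , e) ∷ (s' , e') ∷ rs) = s < s' × s' ≤ e × e < e' × Chain ((s' , e') ∷ rs)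

NonEmptyRow : Row → Set
NonEmptyRow (s , e) = s ≤ e

IsStanley : Rows → Set
IsStanley P = 1 ℕ.≤ length P × All NonEmptyRow P × Chain P

lastE : Rows → ℤ
lastE [] = + 0
lastE ((_ , e) ∷ []) = e
lastE (_ ∷ r ∷ rs) = lastE (r ∷ rs)

columns : Rows → ℤ
columns [] = + 0
columns P@((s , _) ∷ _) = lastE P - s + + 1

firstR : Rows → ℤ
firstR [] = + 0
firstR ((s , e) ∷ _) = e - s + + 1

diagFrom : ℤ → Rows → ℕ
diagFrom x [] = 0
diagFrom x ((s , e) ∷ rs) with s ≤? x | x ≤? e
... | yes _ | yes _ = suc (diagFrom (x + + 1) rs)
... | _ | _ = 0

firstD : Rows → ℕ
firstD [] = 0
firstD P@((s , _) ∷ _) = diagFrom s P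

newBottom : ℕ → Rows → Rows
newBottom ℓ [] = (ℤ.- + 1 , + ℓ) ∷ []   -- not reached for fountains
newBottom ℓ P@((s , _) ∷ _) = (s - + 1 , s + + ℓ) ∷ P

addLeft : ℕ → Rows → Rows
addLeft zero P = P
addLeft (suc ℓ) [] = []
addLeft (suc ℓ) ((s , e) ∷ P) = (s - + 1 , e) ∷ addLeft ℓ P

step : ℕ → Rows → Rows
step k P with k % 2
... | zero = addLeft (k / 2) P
... | suc _ = newBottom (k / 2) P

f : ℕ → List Coin → Rows
f zero _ = []                       -- not used (d ≥ 1)
f (suc zero) _ = (+ 0 , + 1) ∷ []
f (suc (suc d)) C = step (diag C) (f (suc d) (delFirstDiag C))

-- Well-definedness of one step of the recursion for C with d diagonals:
-- C' is a coin fountain with d-1 diagonals, and in the case k = 2ℓ the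
-- polyomino P' = f(C') has at least ℓ rows.
WellDefined : ℕ → List Coin → Set
WellDefined d C = 2 ℕ.≤ d →
  IsCoinFountain (d ℕ.∸ 1) (delFirstDiag C) ×
  (∀ ℓ → diag C ≡ 2 ℕ.* ℓ → ℓ ℕ.≤ length (f (d ℕ.∸ 1) (delFirstDiag C)))

-- Induction on the number of diagonals, following the recursion of f with k = diag C and
-- k′ = diag C′. The first diagonal of C starts at the origin, and each of its coins (j+1, j+1)
-- rests on (j+2, j), a first-diagonal coin of C′; so 1 ≤ k ≤ k′ + 1. For k = 2ℓ, adding a cell
-- to the left of the lowest ℓ rows keeps P′ Stanley, and if ℓ ≤ firstD P′ these rows start at
-- consecutive positions, so the new first diagonal has exactly ℓ cells. For k = 2ℓ + 1, the new
-- bottom row of ℓ + 2 cells keeps the Stanley shape iff it ends before the old first row, that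
-- is ℓ + 2 ≤ firstR P′. The first-row/first-diagonal profile that the theorem gives P′ for k′
-- provides exactly these bounds for every k ≤ k′ + 1, which carries the induction.
module Submission where

open import Defs
open import Data.Nat
  using (ℕ; zero; suc; _+_; _*_; _≤_; _<_; z≤n; s≤s; s≤s⁻¹; ⌊_/2⌋; ⌈_/2⌉; _%_; _/_)
import Data.Nat.Properties as ℕ
open import Data.Nat.DivMod using (%-remove-+ʳ; +-distrib-/-∣ʳ)
open import Data.Nat.Divisibility using (m∣m*n; n/m≡quotient; n∣m⇒m%n≡0)
open import Data.Integer as ℤ using (+_; -[1+_]; +≤+) renaming (_≤_ to _≤ℤ_)
import Data.Integer.Properties as ℤ
open import Data.Integer.Tactic.RingSolver using (solve-∀)
open import Data.Product using (_×_; _,_; proj₁; proj₂; ∃-syntax)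
open import Data.Unit using (tt)
open import Data.List using (List; []; _∷_; length; filter; map)
open import Data.List.Properties using (length-map; length-removeAt′)
open import Data.List.Membership.Propositional using (_∈_)
open import Data.List.Membership.Propositional.Properties
  using (∈-filter⁺; ∈-filter⁻; ∈-map⁺; ∈-map∘filter⁺; ∈-map∘filter⁻; ∈-length)
open import Data.List.Relation.Unary.Any using (here; there; index; _─_)
open import Data.List.Relation.Unary.All using (All; []; _∷_)
import Data.List.Relation.Unary.All as All
open import Data.List.Relation.Unary.AllPairs using ([]; _∷_)
open import Data.List.Relation.Unary.Unique.Propositional using (Unique)
import Data.List.Relation.Unary.Unique.Propositional.Properties as Unique
open import Data.List.Relation.Binary.Subset.Propositional using (_⊆_)
open import Function.Bundles using (mk⇔; Equivalence)
open import Relation.Binary.PropositionalEquality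
open import Relation.Nullary using (Dec; yes; no; contradiction)

module _ {a} {A : Set a} where

  ∈-─ : ∀ {x y : A} {ys} → y ∈ ys → y ≢ x → (x∈ys : x ∈ ys) → y ∈ (ys ─ x∈ys)
  ∈-─ (here refl)  y≢x (here refl)  = contradiction refl y≢x
  ∈-─ (here refl)  _   (there _)    = here refl
  ∈-─ (there y∈ys) _   (here refl)  = y∈ys
  ∈-─ (there y∈ys) y≢x (there x∈ys) = there (∈-─ y∈ys y≢x x∈ys)

  Unique∧⊆⇒length≤ : ∀ {xs ys : List A} → Unique xs → xs ⊆ ys → length xs ≤ length ys
  Unique∧⊆⇒length≤ {[]} _ _ = z≤n
  Unique∧⊆⇒length≤ {x ∷ xs} {ys} (x∉xs ∷ xs!) xs⊆ys = begin
    suc (length xs)          ≤⟨ s≤s (Unique∧⊆⇒length≤ xs! xs⊆ys─x) ⟩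
    suc (length (ys ─ x∈ys)) ≡⟨ length-removeAt′ ys (index x∈ys) ⟨
    length ys                ∎
    where
    open ℕ.≤-Reasoning
    x∈ys = xs⊆ys (here refl)
    xs⊆ys─x : xs ⊆ (ys ─ x∈ys)
    xs⊆ys─x y∈xs =
      ∈-─ (xs⊆ys (there y∈xs)) (λ y≡x → All.lookup x∉xs y∈xs (sym y≡x)) x∈ys

i-1+1≡i : ∀ i → i ℤ.- + 1 ℤ.+ + 1 ≡ i
i-1+1≡i = solve-∀

i+1-1≡i : ∀ i → i ℤ.+ + 1 ℤ.- + 1 ≡ i
i+1-1≡i = solve-∀

i-2+2≡i : ∀ i → i ℤ.- + 2 ℤ.+ + 2 ≡ i
i-2+2≡i = solve-∀

i+2-2≡i : ∀ i → i ℤ.+ + 2 ℤ.- + 2 ≡ i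
i+2-2≡i = solve-∀

i-[j-1]+1≡i-j+1+1 : ∀ i j → i ℤ.- (j ℤ.- + 1) ℤ.+ + 1 ≡ i ℤ.- j ℤ.+ + 1 ℤ.+ + 1
i-[j-1]+1≡i-j+1+1 = solve-∀

i-1<i : ∀ i → i ℤ.- + 1 ℤ.< i
i-1<i i = ℤ.suc[i]≤j⇒i<j (ℤ.≤-reflexive (1+[i-1]≡i i))
  where
  1+[i-1]≡i : ∀ i → + 1 ℤ.+ (i ℤ.- + 1) ≡ i
  1+[i-1]≡i = solve-∀

k≤i-j⇒j≤i-k : ∀ i j {k} → k ≤ℤ i ℤ.- j → j ≤ℤ i ℤ.- k
k≤i-j⇒j≤i-k i j {k} k≤i-j =
  subst₂ _≤ℤ_ (k+[j-k]≡j k j) (i-j+[j-k]≡i-k i j k) (ℤ.+-monoˡ-≤ (j ℤ.- k) k≤i-j)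
  where
  k+[j-k]≡j : ∀ k j → k ℤ.+ (j ℤ.- k) ≡ j
  k+[j-k]≡j = solve-∀
  i-j+[j-k]≡i-k : ∀ i j k → i ℤ.- j ℤ.+ (j ℤ.- k) ≡ i ℤ.- k
  i-j+[j-k]≡i-k = solve-∀

data Parity : ℕ → Set where
  even : ∀ ℓ → Parity (2 * ℓ)
  odd  : ∀ ℓ → Parity (suc (2 * ℓ))

parity : ∀ k → Parity k
parity zero = even 0
parity (suc k) with parity k
... | even ℓ = odd ℓ
... | odd ℓ  = subst Parity (ℕ.*-suc 2 ℓ) (even (suc ℓ))

⌊2*n/2⌋≡n : ∀ n → ⌊ 2 * n /2⌋ ≡ n
⌊2*n/2⌋≡n zero    = refl
⌊2*n/2⌋≡n (suc n) = trans (cong ⌊_/2⌋ (ℕ.*-suc 2 n)) (cong suc (⌊2*n/2⌋≡n n))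

⌈2*n/2⌉≡n : ∀ n → ⌈ 2 * n /2⌉ ≡ n
⌈2*n/2⌉≡n zero    = refl
⌈2*n/2⌉≡n (suc n) = trans (cong ⌈_/2⌉ (ℕ.*-suc 2 n)) (cong suc (⌈2*n/2⌉≡n n))

diagFrom-here : ∀ {x s e} rs → s ≤ℤ x → x ≤ℤ e →
                diagFrom x ((s , e) ∷ rs) ≡ suc (diagFrom (x ℤ.+ + 1) rs)
diagFrom-here {x} {s} {e} rs s≤x x≤e with s ℤ.≤? x | x ℤ.≤? e
... | yes _  | yes _  = refl
... | no s≰x | _      = contradiction s≤x s≰x
... | yes _  | no x≰e = contradiction x≤e x≰e

diagFrom-below : ∀ {x s e} rs → x ℤ.< s → diagFrom x ((s , e) ∷ rs) ≡ 0
diagFrom-below {x} {s} rs x<s with s ℤ.≤? x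
... | yes s≤x = contradiction (ℤ.<-≤-trans x<s s≤x) (ℤ.<-irrefl refl)
... | no _    = refl

diagFrom-cell : ∀ {x s e} rs → 0 < diagFrom x ((s , e) ∷ rs) → s ≤ℤ x × x ≤ℤ e
diagFrom-cell {x} {s} {e} rs pos with s ℤ.≤? x | x ℤ.≤? e
diagFrom-cell rs _  | yes s≤x | yes x≤e = s≤x , x≤e
diagFrom-cell rs () | yes _   | no _
diagFrom-cell rs () | no _    | _

diagFrom≤length : ∀ x P → diagFrom x P ≤ length P
diagFrom≤length x [] = z≤n
diagFrom≤length x ((s , e) ∷ rs) with s ℤ.≤? x | x ℤ.≤? e
... | yes _ | yes _ = s≤s (diagFrom≤length (x ℤ.+ + 1) rs)
... | yes _ | no _  = z≤n
... | no _  | _     = z≤n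

firstD≤length : ∀ P → firstD P ≤ length P
firstD≤length []             = z≤n
firstD≤length ((s , e) ∷ rs) = diagFrom≤length s ((s , e) ∷ rs)

length-addLeft : ∀ ℓ P → length (addLeft ℓ P) ≡ length P
length-addLeft zero    P       = refl
length-addLeft (suc ℓ) []      = refl
length-addLeft (suc ℓ) (_ ∷ P) = cong suc (length-addLeft ℓ P)

lastE-addLeft : ∀ ℓ P → lastE (addLeft ℓ P) ≡ lastE P
lastE-addLeft zero          P            = refl
lastE-addLeft (suc ℓ)       []           = refl
lastE-addLeft (suc zero)    (_ ∷ [])     = refl
lastE-addLeft (suc (suc ℓ)) (_ ∷ [])     = refl
lastE-addLeft (suc zero)    (_ ∷ _ ∷ _)  = refl
lastE-addLeft (suc (suc ℓ)) (_ ∷ r ∷ rs) = lastE-addLeft (suc ℓ) (r ∷ rs)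

addLeft-nonEmpty : ∀ ℓ P → All NonEmptyRow P → All NonEmptyRow (addLeft ℓ P)
addLeft-nonEmpty zero    P             rows         = rows
addLeft-nonEmpty (suc ℓ) []            []           = []
addLeft-nonEmpty (suc ℓ) ((s , e) ∷ P) (s≤e ∷ rows) =
  ℤ.≤-trans (ℤ.i-j≤i s (+ 1)) s≤e ∷ addLeft-nonEmpty ℓ P rows

addLeft-chain : ∀ ℓ P → Chain P → Chain (addLeft ℓ P)
addLeft-chain zero          P        chain = chain
addLeft-chain (suc ℓ)       []       _     = tt
addLeft-chain (suc zero)    (_ ∷ []) _     = tt
addLeft-chain (suc (suc ℓ)) (_ ∷ []) _     = tt
addLeft-chain (suc zero) ((s , e) ∷ (s′ , e′) ∷ rs) (s<s′ , s′≤e , e<e′ , chain) =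
  ℤ.<-trans (i-1<i s) s<s′ , s′≤e , e<e′ , chain
addLeft-chain (suc (suc ℓ)) ((s , e) ∷ (s′ , e′) ∷ rs) (s<s′ , s′≤e , e<e′ , chain) =
  ℤ.+-monoˡ-< (ℤ.- + 1) s<s′ , ℤ.≤-trans (ℤ.i-j≤i s′ (+ 1)) s′≤e , e<e′ ,
  addLeft-chain (suc ℓ) ((s′ , e′) ∷ rs) chain

addLeft-isStanley : ∀ ℓ {P} → IsStanley P → IsStanley (addLeft ℓ P)
addLeft-isStanley ℓ {P} (nonNil , rows , chain) =
  subst (1 ≤_) (sym (length-addLeft ℓ P)) nonNil ,
  addLeft-nonEmpty ℓ P rows ,
  addLeft-chain ℓ P chain

columns-addLeft : ∀ ℓ s e P →
                  columns (addLeft (suc ℓ) ((s , e) ∷ P)) ≡ columns ((s , e) ∷ P) ℤ.+ + 1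
columns-addLeft ℓ s e P =
  trans (cong (λ L → L ℤ.- (s ℤ.- + 1) ℤ.+ + 1) (lastE-addLeft (suc ℓ) ((s , e) ∷ P)))
        (i-[j-1]+1≡i-j+1+1 (lastE ((s , e) ∷ P)) s)

firstR-addLeft : ∀ ℓ s e P →
                 firstR (addLeft (suc ℓ) ((s , e) ∷ P)) ≡ firstR ((s , e) ∷ P) ℤ.+ + 1
firstR-addLeft ℓ s e P = i-[j-1]+1≡i-j+1+1 e s

-- Left ends strictly increase along a chain, so a diagonal of length ℓ from x + 1 forces the
-- next ℓ rows to start at x + 1, x + 2, …; shifted left they carry the diagonal from x, and
-- the row after them starts too far right to continue it.
diagFrom-addLeft : ∀ ℓ x e rs → Chain ((x , e) ∷ rs) → ℓ ≤ diagFrom (x ℤ.+ + 1) rs →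
                   diagFrom x (addLeft ℓ rs) ≡ ℓ
diagFrom-addLeft zero    x e []              _         _ = refl
diagFrom-addLeft zero    x e ((s , e′) ∷ rs) (x<s , _) _ = diagFrom-below rs x<s
diagFrom-addLeft (suc ℓ) x e ((s , e′) ∷ rs) (x<s , _ , _ , chain) ℓ<diag
  with s≤x+1 , x+1≤e′ ← diagFrom-cell rs (ℕ.≤-trans (s≤s z≤n) ℓ<diag)
  with refl ← ℤ.≤-antisym s≤x+1 (subst (_≤ℤ s) (ℤ.+-comm (+ 1) x) (ℤ.i<j⇒suc[i]≤j x<s)) =
  trans (diagFrom-here (addLeft ℓ rs) (ℤ.≤-reflexive (i+1-1≡i x)) x≤e′)
        (cong suc (diagFrom-addLeft ℓ (x ℤ.+ + 1) e′ rs chain ℓ≤diag))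
  where
  x≤e′ = ℤ.≤-trans (ℤ.i≤i+j x (+ 1)) x+1≤e′
  ℓ≤diag = s≤s⁻¹ (subst (suc ℓ ≤_) (diagFrom-here rs ℤ.≤-refl x+1≤e′) ℓ<diag)

firstD-addLeft : ∀ ℓ s e rs → Chain ((s , e) ∷ rs) → suc ℓ ≤ firstD ((s , e) ∷ rs) →
                 firstD (addLeft (suc ℓ) ((s , e) ∷ rs)) ≡ suc ℓ
firstD-addLeft ℓ s e rs chain ℓ<firstD = begin
  diagFrom (s ℤ.- + 1) ((s ℤ.- + 1 , e) ∷ addLeft ℓ rs)
    ≡⟨ diagFrom-here (addLeft ℓ rs) ℤ.≤-refl (ℤ.≤-trans (ℤ.i-j≤i s (+ 1)) s≤e) ⟩
  suc (diagFrom (s ℤ.- + 1 ℤ.+ + 1) (addLeft ℓ rs))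
    ≡⟨ cong (λ x → suc (diagFrom x (addLeft ℓ rs))) (i-1+1≡i s) ⟩
  suc (diagFrom s (addLeft ℓ rs))
    ≡⟨ cong suc (diagFrom-addLeft ℓ s e rs chain ℓ≤diag) ⟩
  suc ℓ ∎
  where
  open ≡-Reasoning
  s≤e = proj₂ (diagFrom-cell rs (ℕ.≤-trans (s≤s z≤n) ℓ<firstD))
  ℓ≤diag = s≤s⁻¹ (subst (suc ℓ ≤_) (diagFrom-here rs ℤ.≤-refl s≤e) ℓ<firstD)

columns-newBottom : ∀ ℓ s e P →
                    columns (newBottom ℓ ((s , e) ∷ P)) ≡ columns ((s , e) ∷ P) ℤ.+ + 1
columns-newBottom ℓ s e P = i-[j-1]+1≡i-j+1+1 (lastE ((s , e) ∷ P)) s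

firstR-newBottom : ∀ ℓ s e P → firstR (newBottom ℓ ((s , e) ∷ P)) ≡ + (ℓ + 2)
firstR-newBottom ℓ s e P = s+i-[s-1]+1≡i+2 s (+ ℓ)
  where
  s+i-[s-1]+1≡i+2 : ∀ s i → s ℤ.+ i ℤ.- (s ℤ.- + 1) ℤ.+ + 1 ≡ i ℤ.+ + 2
  s+i-[s-1]+1≡i+2 = solve-∀

firstD-newBottom : ∀ ℓ s e P → firstD (newBottom ℓ ((s , e) ∷ P)) ≡ suc (firstD ((s , e) ∷ P))
firstD-newBottom ℓ s e P =
  trans (diagFrom-here ((s , e) ∷ P) ℤ.≤-refl (ℤ.≤-trans (ℤ.i-j≤i s (+ 1)) (ℤ.i≤i+j s (+ ℓ))))
        (cong (λ x → suc (diagFrom x ((s , e) ∷ P))) (i-1+1≡i s))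

newBottom-isStanley : ∀ ℓ s e P → IsStanley ((s , e) ∷ P) → + (ℓ + 2) ≤ℤ firstR ((s , e) ∷ P) →
                      IsStanley (newBottom ℓ ((s , e) ∷ P))
newBottom-isStanley ℓ s e P (_ , rows , chain) ℓ+2≤firstR =
  s≤s z≤n ,
  ℤ.≤-trans (ℤ.i-j≤i s (+ 1)) (ℤ.i≤i+j s (+ ℓ)) ∷ rows ,
  i-1<i s , ℤ.i≤i+j s (+ ℓ) , s+ℓ<e , chain
  where
  i+2+[s-1]≡1+[s+i] : ∀ i s → i ℤ.+ + 2 ℤ.+ (s ℤ.- + 1) ≡ + 1 ℤ.+ (s ℤ.+ i)
  i+2+[s-1]≡1+[s+i] = solve-∀
  e-s+1+[s-1]≡e : ∀ e s → e ℤ.- s ℤ.+ + 1 ℤ.+ (s ℤ.- + 1) ≡ e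
  e-s+1+[s-1]≡e = solve-∀
  s+ℓ<e : s ℤ.+ + ℓ ℤ.< e
  s+ℓ<e = ℤ.suc[i]≤j⇒i<j (subst₂ _≤ℤ_ (i+2+[s-1]≡1+[s+i] (+ ℓ) s) (e-s+1+[s-1]≡e e s)
                                  (ℤ.+-monoˡ-≤ (s ℤ.- + 1) ℓ+2≤firstR))

step-%2≡0 : ∀ k P → k % 2 ≡ 0 → step k P ≡ addLeft (k / 2) P
step-%2≡0 k P k%2≡0 with k % 2
... | zero = refl

step-%2≡1 : ∀ k P → k % 2 ≡ 1 → step k P ≡ newBottom (k / 2) P
step-%2≡1 k P k%2≡1 with k % 2
... | suc _ = refl

step-even : ∀ ℓ P → step (2 * ℓ) P ≡ addLeft ℓ P
step-even ℓ P = trans (step-%2≡0 (2 * ℓ) P (n∣m⇒m%n≡0 (2 * ℓ) 2 2∣2ℓ))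
                      (cong (λ h → addLeft h P) (n/m≡quotient 2∣2ℓ))
  where
  2∣2ℓ = m∣m*n {2} ℓ

step-odd : ∀ ℓ P → step (suc (2 * ℓ)) P ≡ newBottom ℓ P
step-odd ℓ P =
  trans (step-%2≡1 (suc (2 * ℓ)) P (%-remove-+ʳ 1 2∣2ℓ))
        (cong (λ h → newBottom h P) (trans (+-distrib-/-∣ʳ 1 2∣2ℓ) (n/m≡quotient 2∣2ℓ)))
  where
  2∣2ℓ = m∣m*n {2} ℓ

EvenProfile : ℕ → Rows → Set
EvenProfile k P = ∀ ℓ → 1 ≤ ℓ → k ≡ 2 * ℓ → firstD P ≡ ℓ × + (ℓ + 2) ≤ℤ firstR P

OddProfile : ℕ → Rows → Set
OddProfile k P = ∀ ℓ → k ≡ 2 * ℓ + 1 → ℓ + 1 ≤ firstD P × firstR P ≡ + (ℓ + 2)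

Profile : ℕ → Rows → Set
Profile k P = EvenProfile k P × OddProfile k P

profile-even : ∀ ℓ {P} → firstD P ≡ ℓ → + (ℓ + 2) ≤ℤ firstR P → Profile (2 * ℓ) P
profile-even ℓ {P} firstD≡ℓ ℓ+2≤firstR = evenPart , oddPart
  where
  evenPart : EvenProfile (2 * ℓ) P
  evenPart ℓ′ _ eq with refl ← ℕ.*-cancelˡ-≡ ℓ ℓ′ 2 eq = firstD≡ℓ , ℓ+2≤firstR
  oddPart : OddProfile (2 * ℓ) P
  oddPart ℓ′ eq = contradiction (trans eq (ℕ.+-comm (2 * ℓ′) 1)) (ℕ.even≢odd ℓ ℓ′)

profile-odd : ∀ ℓ {P} → suc ℓ ≤ firstD P → firstR P ≡ + (ℓ + 2) → Profile (suc (2 * ℓ)) P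
profile-odd ℓ {P} ℓ<firstD firstR≡ℓ+2 = evenPart , oddPart
  where
  evenPart : EvenProfile (suc (2 * ℓ)) P
  evenPart ℓ′ _ eq = contradiction (sym eq) (ℕ.even≢odd ℓ′ ℓ)
  oddPart : OddProfile (suc (2 * ℓ)) P
  oddPart ℓ′ eq
    with refl ← ℕ.*-cancelˡ-≡ ℓ ℓ′ 2 (ℕ.suc-injective (trans eq (ℕ.+-comm (2 * ℓ′) 1))) =
    subst (_≤ firstD P) (ℕ.+-comm 1 ℓ) ℓ<firstD , firstR≡ℓ+2

Room : ℕ → Rows → Set
Room k P = ⌊ k /2⌋ ≤ firstD P × + suc ⌈ k /2⌉ ≤ℤ firstR P

Room-mono : ∀ {j k P} → k ≤ j → Room j P → Room k P
Room-mono k≤j (firstD≥ , firstR≥) =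
  ℕ.≤-trans (ℕ.⌊n/2⌋-mono k≤j) firstD≥ ,
  ℤ.≤-trans (+≤+ (s≤s (ℕ.⌈n/2⌉-mono k≤j))) firstR≥

Profile⇒Room : ∀ {k P} → 1 ≤ k → Profile k P → Room (suc k) P
Profile⇒Room {k} 1≤k profile with parity k
Profile⇒Room () _ | even zero
Profile⇒Room _ (evenPart , _) | even (suc m) with evenPart (suc m) (s≤s z≤n) refl
... | firstD≡ , firstR≥ =
  ℕ.≤-reflexive (trans (⌈2*n/2⌉≡n (suc m)) (sym firstD≡)) ,
  ℤ.≤-trans (+≤+ (ℕ.≤-reflexive (trans (cong (λ h → suc (suc h)) (⌊2*n/2⌋≡n (suc m)))
                                        (ℕ.+-comm 2 (suc m)))))
            firstR≥
Profile⇒Room _ (_ , oddPart) | odd ℓ with oddPart ℓ (ℕ.+-comm 1 (2 * ℓ))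
... | firstD≥ , firstR≡ =
  ℕ.≤-trans (ℕ.≤-reflexive (trans (cong suc (⌊2*n/2⌋≡n ℓ)) (ℕ.+-comm 1 ℓ))) firstD≥ ,
  ℤ.≤-reflexive (trans (cong (λ h → + suc (suc h)) (⌈2*n/2⌉≡n ℓ))
                       (trans (cong +_ (ℕ.+-comm 2 ℓ)) (sym firstR≡)))

StepShape : ℕ → Rows → Rows → Set
StepShape k P Q = IsStanley Q × columns Q ≡ columns P ℤ.+ + 1 × Profile k Q

addLeft-shape : ∀ m P → IsStanley P → Room (2 * suc m) P →
                StepShape (2 * suc m) P (addLeft (suc m) P)
addLeft-shape m [] (() , _) _
addLeft-shape m ((s , e) ∷ rs) stanley@(_ , _ , chain) (firstD≥ , firstR≥) =
  addLeft-isStanley (suc m) stanley ,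
  columns-addLeft m s e rs ,
  profile-even (suc m) (firstD-addLeft m s e rs chain (subst (_≤ _) (⌊2*n/2⌋≡n (suc m)) firstD≥))
                       m+3≤firstR
  where
  open ℤ.≤-Reasoning
  m+3≤firstR : + (suc m + 2) ≤ℤ firstR (addLeft (suc m) ((s , e) ∷ rs))
  m+3≤firstR = begin
    + (suc m + 2)
      ≡⟨ cong (λ h → + suc h) (trans (ℕ.+-suc m 1) (cong (_+ 1) (sym (⌈2*n/2⌉≡n (suc m))))) ⟩
    + suc ⌈ 2 * suc m /2⌉ ℤ.+ + 1
      ≤⟨ ℤ.+-monoˡ-≤ (+ 1) firstR≥ ⟩
    firstR ((s , e) ∷ rs) ℤ.+ + 1
      ≡⟨ firstR-addLeft m s e rs ⟨
    firstR (addLeft (suc m) ((s , e) ∷ rs)) ∎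

newBottom-shape : ∀ ℓ P → IsStanley P → Room (suc (2 * ℓ)) P →
                  StepShape (suc (2 * ℓ)) P (newBottom ℓ P)
newBottom-shape ℓ [] (() , _) _
newBottom-shape ℓ ((s , e) ∷ rs) stanley (firstD≥ , firstR≥) =
  newBottom-isStanley ℓ s e rs stanley ℓ+2≤firstR ,
  columns-newBottom ℓ s e rs ,
  profile-odd ℓ (subst (suc ℓ ≤_) (sym (firstD-newBottom ℓ s e rs))
                       (s≤s (subst (_≤ _) (⌈2*n/2⌉≡n ℓ) firstD≥)))
                (firstR-newBottom ℓ s e rs)
  where
  ℓ+2≡2+⌊2ℓ/2⌋ : ℓ + 2 ≡ suc (suc ⌊ 2 * ℓ /2⌋)
  ℓ+2≡2+⌊2ℓ/2⌋ = trans (ℕ.+-comm ℓ 2) (cong (λ h → suc (suc h)) (sym (⌊2*n/2⌋≡n ℓ)))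
  ℓ+2≤firstR : + (ℓ + 2) ≤ℤ firstR ((s , e) ∷ rs)
  ℓ+2≤firstR = ℤ.≤-trans (+≤+ (ℕ.≤-reflexive ℓ+2≡2+⌊2ℓ/2⌋)) firstR≥

step-shape : ∀ k P → 1 ≤ k → IsStanley P → Room k P → StepShape k P (step k P)
step-shape k P 1≤k stanley room with parity k
step-shape _ P () _ _ | even zero
step-shape _ P _ stanley room | even (suc m) =
  subst (StepShape (2 * suc m) P) (sym (step-even (suc m) P)) (addLeft-shape m P stanley room)
step-shape _ P _ stanley room | odd ℓ =
  subst (StepShape (suc (2 * ℓ)) P) (sym (step-odd ℓ P)) (newBottom-shape ℓ P stanley room)

onFirstDiag? : (c : Coin) → Dec (proj₁ c ≡ + proj₂ c)
onFirstDiag? c = proj₁ c ℤ.≟ + proj₂ c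

offFirstDiag? : (c : Coin) → Dec (+ 2 ≤ℤ proj₁ c ℤ.- + proj₂ c)
offFirstDiag? c = + 2 ℤ.≤? (proj₁ c ℤ.- + proj₂ c)

shiftLeft : Coin → Coin
shiftLeft c = (proj₁ c ℤ.- + 2 , proj₂ c)

shiftLeft-injective : ∀ {x y} → shiftLeft x ≡ shiftLeft y → x ≡ y
shiftLeft-injective {a , j} {b , k} eq with refl ← cong proj₂ eq =
  cong (_, j) (trans (sym (i-2+2≡i a)) (trans (cong (ℤ._+ + 2) (cong proj₁ eq)) (i-2+2≡i b)))

∈-delFirstDiag⁻ : ∀ {C a j} → (a , j) ∈ delFirstDiag C → (a ℤ.+ + 2 , j) ∈ C × + j ≤ℤ a
∈-delFirstDiag⁻ {C} a∈C′ with ∈-map∘filter⁻ shiftLeft offFirstDiag? {xs = C} a∈C′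
... | (b , k) , b∈C , refl , 2≤b-k =
  subst (λ x → (x , k) ∈ C) (sym (i-2+2≡i b)) b∈C , k≤i-j⇒j≤i-k b (+ k) 2≤b-k

∈-delFirstDiag⁺ : ∀ {C a j} → (a ℤ.+ + 2 , j) ∈ C → + j ≤ℤ a → (a , j) ∈ delFirstDiag C
∈-delFirstDiag⁺ {C} {a} {j} a+2∈C j≤a =
  ∈-map∘filter⁺ shiftLeft offFirstDiag? {xs = C}
    (_ , a+2∈C , cong (_, j) (sym (i+2-2≡i a)) ,
     k≤i-j⇒j≤i-k (a ℤ.+ + 2) (+ 2) (subst (+ j ≤ℤ_) (sym (i+2-2≡i a)) j≤a))

module _ {d C} (fountain : IsCoinFountain d C) where
  open IsCoinFountain fountain

  descend : ∀ {a} j → (a , j) ∈ C → (a ℤ.+ + j , 0) ∈ C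
  descend {a} zero    a∈C = subst (λ x → (x , 0) ∈ C) (sym (ℤ.+-identityʳ a)) a∈C
  descend {a} (suc j) a∈C =
    subst (λ x → (x , 0) ∈ C) (a+1+j≡a+[1+j] a (+ j)) (descend j (proj₂ (support a j a∈C)))
    where
    a+1+j≡a+[1+j] : ∀ a j → a ℤ.+ + 1 ℤ.+ j ≡ a ℤ.+ (+ 1 ℤ.+ j)
    a+1+j≡a+[1+j] = solve-∀

  diag≤suc-diag-delFirstDiag : diag C ≤ suc (diag (delFirstDiag C))
  diag≤suc-diag-delFirstDiag =
    subst (diag C ≤_) (cong suc (length-map raise (filter onFirstDiag? (delFirstDiag C))))
          (Unique∧⊆⇒length≤ (Unique.filter⁺ onFirstDiag? noDup) diagC⊆)
    where
    raise : Coin → Coin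
    raise c = (+ suc (proj₂ c) , suc (proj₂ c))
    diagC⊆ : filter onFirstDiag? C ⊆ ((+ 0 , 0) ∷ map raise (filter onFirstDiag? (delFirstDiag C)))
    diagC⊆ {a , j} c∈ with ∈-filter⁻ onFirstDiag? {xs = C} c∈
    ... | c∈C , refl with j
    ... | zero  = here refl
    ... | suc j = there (∈-map⁺ raise (∈-filter⁺ onFirstDiag? (∈-delFirstDiag⁺ below ℤ.≤-refl) refl))
      where
      below : (+ j ℤ.+ + 2 , j) ∈ C
      below = subst (λ x → (x , j) ∈ C) (cong +_ (sym (ℕ.+-suc j 1)))
                    (proj₂ (support (+ suc j) j c∈C))

module _ {d C} (fountain : IsCoinFountain (suc d) C) where
  open IsCoinFountain fountain

  1≤diag : 1 ≤ diag C
  1≤diag = ∈-length (∈-filter⁺ onFirstDiag? origin∈C refl)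
    where
    origin∈C = Equivalence.from (row0 (+ 0)) (0 , s≤s z≤n , refl)

  isCoinFountain-delFirstDiag : IsCoinFountain d (delFirstDiag C)
  isCoinFountain-delFirstDiag = record
    { noDup   = Unique.map⁺ shiftLeft-injective (Unique.filter⁺ offFirstDiag? noDup)
    ; row0    = λ a → mk⇔ (row0-to a) (row0-from a)
    ; support = support′
    }
    where
    row0-to : ∀ a → (a , 0) ∈ delFirstDiag C → ∃[ i ] (i < d × a ≡ + (2 * i))
    row0-to -[1+ n ] a∈C′ with () ← proj₂ (∈-delFirstDiag⁻ {C} a∈C′)
    row0-to (+ n) a∈C′ with Equivalence.to (row0 (+ n ℤ.+ + 2)) (proj₁ (∈-delFirstDiag⁻ {C} a∈C′))
    ... | zero , _ , n+2≡0 = contradiction (ℕ.m+n≡0⇒n≡0 n (ℤ.+-injective n+2≡0)) (λ ())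
    ... | suc i , s≤s i<d , n+2≡2+2i =
      i , i<d , cong +_ (ℕ.+-cancelʳ-≡ 2 n (2 * i) (begin
        n + 2         ≡⟨ ℤ.+-injective n+2≡2+2i ⟩
        2 * suc i     ≡⟨ ℕ.*-suc 2 i ⟩
        2 + 2 * i     ≡⟨ ℕ.+-comm 2 (2 * i) ⟩
        2 * i + 2     ∎))
      where open ≡-Reasoning

    row0-from : ∀ a → ∃[ i ] (i < d × a ≡ + (2 * i)) → (a , 0) ∈ delFirstDiag C
    row0-from _ (i , i<d , refl) =
      ∈-delFirstDiag⁺ (Equivalence.from (row0 _) (suc i , s≤s i<d , 2i+2≡2+2i)) (+≤+ z≤n)
      where
      2i+2≡2+2i = cong +_ (trans (ℕ.+-comm (2 * i) 2) (sym (ℕ.*-suc 2 i)))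

    support′ : ∀ a j → (a , suc j) ∈ delFirstDiag C →
               (a ℤ.- + 1 , j) ∈ delFirstDiag C × (a ℤ.+ + 1 , j) ∈ delFirstDiag C
    support′ a j a∈C′
      with a+2∈C , j<a ← ∈-delFirstDiag⁻ {C} a∈C′
      with left , right ← support (a ℤ.+ + 2) j a+2∈C =
      ∈-delFirstDiag⁺ (subst (λ x → (x , j) ∈ C) (a+2-1≡a-1+2 a) left)
                      (ℤ.+-monoˡ-≤ (ℤ.- + 1) {+ suc j} j<a) ,
      ∈-delFirstDiag⁺ (subst (λ x → (x , j) ∈ C) (a+2+1≡a+1+2 a) right)
                      (ℤ.≤-trans (+≤+ (ℕ.n≤1+n j)) (ℤ.≤-trans j<a (ℤ.i≤i+j a (+ 1))))
      where
      a+2-1≡a-1+2 : ∀ a → a ℤ.+ + 2 ℤ.- + 1 ≡ a ℤ.- + 1 ℤ.+ + 2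
      a+2-1≡a-1+2 = solve-∀
      a+2+1≡a+1+2 : ∀ a → a ℤ.+ + 2 ℤ.+ + 1 ≡ a ℤ.+ + 1 ℤ.+ + 2
      a+2+1≡a+1+2 = solve-∀

diag≤1 : ∀ {C} → IsCoinFountain 1 C → diag C ≤ 1
diag≤1 {C} fountain = Unique∧⊆⇒length≤ (Unique.filter⁺ onFirstDiag? noDup) diagC⊆origin
  where
  open IsCoinFountain fountain
  diagC⊆origin : filter onFirstDiag? C ⊆ ((+ 0 , 0) ∷ [])
  diagC⊆origin {a , j} c∈ with ∈-filter⁻ onFirstDiag? {xs = C} c∈
  ... | c∈C , refl with Equivalence.to (row0 _) (descend fountain j c∈C)
  ... | zero  , _      , j+j≡0 with refl ← ℕ.m+n≡0⇒m≡0 j (ℤ.+-injective j+j≡0) = here refl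
  ... | suc _ , s≤s () , _

Room-delFirstDiag : ∀ {d C} P → IsCoinFountain (suc (suc d)) C →
                    Profile (diag (delFirstDiag C)) P → Room (diag C) P
Room-delFirstDiag P fountain profile =
  Room-mono {P = P} (diag≤suc-diag-delFirstDiag fountain)
            (Profile⇒Room {P = P} (1≤diag (isCoinFountain-delFirstDiag fountain)) profile)

f-shape : ∀ n C → IsCoinFountain (suc n) C →
          IsStanley (f (suc n) C) × columns (f (suc n) C) ≡ + (suc n + 1) × Profile (diag C) (f (suc n) C)
f-shape zero C fountain =
  (s≤s z≤n , +≤+ z≤n ∷ [] , tt) , refl ,
  subst (λ k → Profile k (f 1 C)) (ℕ.≤-antisym (1≤diag fountain) (diag≤1 fountain))
        (profile-odd 0 {f 1 C} (s≤s z≤n) refl)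
f-shape (suc n) C fountain
  with stanley′ , columns′ , profile′ ← f-shape n (delFirstDiag C) (isCoinFountain-delFirstDiag fountain)
  with stanley , columns+1 , profile ←
         step-shape (diag C) (f (suc n) (delFirstDiag C)) (1≤diag fountain) stanley′
                    (Room-delFirstDiag (f (suc n) (delFirstDiag C)) fountain profile′) =
  stanley ,
  trans columns+1 (trans (cong (ℤ._+ + 1) columns′) (cong +_ (ℕ.+-comm (suc n + 1) 1))) ,
  profile

wellDefined : ∀ n C → IsCoinFountain (suc n) C → WellDefined (suc n) C
wellDefined zero    C fountain (s≤s ())
wellDefined (suc n) C fountain _ = fountain′ , ℓ≤length
  where
  fountain′ = isCoinFountain-delFirstDiag fountain
  P′ = f (suc n) (delFirstDiag C)
  room = Room-delFirstDiag P′ fountain (proj₂ (proj₂ (f-shape n (delFirstDiag C) fountain′)))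
  ℓ≤length : ∀ ℓ → diag C ≡ 2 * ℓ → ℓ ≤ length P′
  ℓ≤length ℓ diag≡2ℓ =
    ℕ.≤-trans (subst (_≤ firstD P′) (trans (cong ⌊_/2⌋ diag≡2ℓ) (⌊2*n/2⌋≡n ℓ)) (proj₁ room))
              (firstD≤length P′)

lemma2p11 : (d : ℕ) (C : List Coin) → 1 ≤ d → IsCoinFountain d C →
    WellDefined d C ×
    IsStanley (f d C) ×
    columns (f d C) ≡ + (d + 1) ×
    (∀ ℓ → 1 ≤ ℓ → diag C ≡ 2 * ℓ →
      firstD (f d C) ≡ ℓ × + (ℓ + 2) ≤ℤ firstR (f d C)) ×
    (∀ ℓ → diag C ≡ 2 * ℓ + 1 →
      ℓ + 1 ≤ firstD (f d C) × firstR (f d C) ≡ + (ℓ + 2))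
lemma2p11 (suc n) C _ fountain = wellDefined n C fountain , f-shape n C fountain
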